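{- Every $(\leq,\circ)$-structure $\mathcal{S}\in R(\sqsubseteq,;)$ satisfies $\sigma$, i.e. for all $a,b\in\mathcal{S}$, if $b\blacktriangleleft a$ and $a\triangleleft^b b$ then $a\leq b$ (equivalently, $\mathcal{S}$ satisfies $\sigma_n$ for every $n<\omega$).
   Context: For binary relations $R,S$ on a set $X$: $R;S=\{(x,y):\exists z\,((x,z)\in R\wedge(z,y)\in S)\}$; $\mathrm{dom}(S)=\{x:\exists y\,(x,y)\in S\}$; $R\restriction_{Y}=\{(x,y)\in R: x\in Y\}$; demonic refinement is $R\sqsubseteq S\iff(\mathrm{dom}(S)\subseteq\mathrm{dom}(R)\wedge R\restriction_{\mathrm{dom}(S)}\subseteq S)$. A $(\leq,\circ)$-structure is a set with a binary relation $\leq$ and a binary operation $\circ$. $R(\sqsubseteq,;)$ is the class of $(\leq,\circ)$-structures isomorphic to a set of binary relations on some base set, closed under $;$, with $\leq$ interpreted as $\sqsubseteq$ and $\circ$ as $;$. In a $(\leq,\circ)$-structure, define for $n<\omega$ predicates recursively: $a\blacktriangleleft_0 b\iff a\geq b\ \vee\ \exists c\,(a\geq b\circ c)$; $a\triangleleft^s_0 b\iff (a\leq b\wedge s=b)$; $a\blacktriangleleft_{n+1}b\iff a\triangleleft^a_n b\ \vee\ \exists c\,(a\blacktriangleleft_n c\wedge c\blacktriangleleft_n b)\ \vee\ \exists d,f,f'\,(a=d\circ f\wedge f\blacktriangleleft_n f'\wedge b=d\circ f')$; $a\triangleleft^s_{n+1}b\iff \exists c\,(a\triangleleft^s_n c\wedge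 c\triangleleft^s_n b)\ \vee\ \exists c,c',d,d'\,(a=c\circ d\wedge c\triangleleft^s_n c'\wedge d\triangleleft^d_n d'\wedge b=c'\circ d')\ \vee\ \exists s'\,(a\triangleleft^{s'}_n b\wedge s\blacktriangleleft_n s')$. $a\blacktriangleleft b$ iff $a\blacktriangleleft_n b$ for some $n$; $a\triangleleft^s b$ iff $a\triangleleft^s_n b$ for some $n$. The first-order formula $\sigma_n$ is $\forall a,b\,((b\blacktriangleleft_n a\wedge a\triangleleft^b_n b)\rightarrow a\leq b)$, and $\sigma$ is $\forall a,b\,((b\blacktriangleleft a\wedge a\triangleleft^b b)\rightarrow a\leq b)$. -}

module Defs where

open import Data.Nat using (ℕ; zero; suc)
open import Data.Product using (Σ; ∃; _×_; _,_)
open import Data.Sum using (_⊎_)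
open import Relation.Binary.PropositionalEquality using (_≡_)

BinRel : Set → Set₁
BinRel X = X → X → Set

_⨾_ : {X : Set} → BinRel X → BinRel X → BinRel X
(R ⨾ S) x y = ∃ λ z → R x z × S z y

dom : {X : Set} → BinRel X → X → Set
dom S x = ∃ λ y → S x y

_≐_ : {X : Set} → BinRel X → BinRel X → Set
R ≐ S = ∀ x y → (R x y → S x y) × (S x y → R x y)

_⊑_ : {X : Set} → BinRel X → BinRel X → Set
R ⊑ S = (∀ x → dom S x → dom R x) × (∀ x y → R x y → dom S x → S x y)

-- Membership in R(⊑,;): a (≤,∘)-structure is representable if there is a
-- base set X and a map θ into binary relations on X which is injective
-- (up to extensional equality of relations), sends ∘ to ; and such that
-- a ≤ b iff θ a ⊑ θ b. (Its image is then a set of relations closed under ;,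
-- and θ is an isomorphism onto it.)

record Representation (S : Set) (_≤_ : S → S → Set) (_∘_ : S → S → S) : Set₁ where
  field
    Base   : Set
    θ      : S → BinRel Base
    inj    : ∀ a b → θ a ≐ θ b → a ≡ b
    hom-∘  : ∀ a b → θ (a ∘ b) ≐ (θ a ⨾ θ b)
    ≤⇒⊑    : ∀ a b → a ≤ b → θ a ⊑ θ b
    ⊑⇒≤    : ∀ a b → θ a ⊑ θ b → a ≤ b

module Predicates (S : Set) (_≤_ : S → S → Set) (_∘_ : S → S → S) where

  _≥_ : S → S → Set
  a ≥ b = b ≤ a

  mutual
    ◀ : ℕ → S → S → Set
    ◀ zero a b = (a ≥ b) ⊎ (∃ λ c → a ≥ (b ∘ c))
    ◀ (suc n) a b =
      ◁ n a a b
      ⊎ ((∃ λ c → ◀ n a c × ◀ n c b)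
      ⊎ (∃ λ d → ∃ λ f → ∃ λ f' → (a ≡ d ∘ f) × ◀ n f f' × (b ≡ d ∘ f')))

    -- ◁ n s a b   is   a ◁ˢₙ b
    ◁ : ℕ → S → S → S → Set
    ◁ zero s a b = (a ≤ b) × (s ≡ b)
    ◁ (suc n) s a b =
      (∃ λ c → ◁ n s a c × ◁ n s c b)
      ⊎ ((∃ λ c → ∃ λ c' → ∃ λ d → ∃ λ d' →
            (a ≡ c ∘ d) × ◁ n s c c' × ◁ n d d d' × (b ≡ c' ∘ d'))
      ⊎ (∃ λ s' → ◁ n s' a b × ◀ n s s'))

  ◀∞ : S → S → Set
  ◀∞ a b = ∃ λ n → ◀ n a b

  ◁∞ : S → S → S → Set
  ◁∞ s a b = ∃ λ n → ◁ n s a b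

  σ : Set
  σ = ∀ a b → ◀∞ b a → ◁∞ b a b → a ≤ b

module Submission where

open import Defs
open import Data.Nat using (ℕ; zero; suc)
open import Data.Product using (_,_; proj₁; proj₂; swap)
open import Data.Sum using (inj₁; inj₂)
open import Relation.Binary.PropositionalEquality using (refl)

-- In a representation θ, the predicate b ◀ a says dom θb ⊆ dom θa, and
-- a ◁ˢ b says that θa restricted to dom θs is contained in θb.  Every clause
-- of the recursive definitions preserves these readings, and the two
-- conclusions for b ◀ a and a ◁ᵇ b together are exactly θa ⊑ θb, i.e. a ≤ b.

module _ {X : Set} where

  infix 4 _⊆ᵈ_ _↾_⊆_

  _⊆ᵈ_ : BinRel X → BinRel X → Set
  R ⊆ᵈ S = ∀ x → dom R x → dom S x

  -- R ↾ T ⊆ S  is  R↾dom(T) ⊆ S,  so that  R ⊑ S  unfolds to  S ⊆ᵈ R × R ↾ S ⊆ S.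
  _↾_⊆_ : BinRel X → BinRel X → BinRel X → Set
  R ↾ T ⊆ S = ∀ x y → R x y → dom T x → S x y

  ≐-sym : {R S : BinRel X} → R ≐ S → S ≐ R
  ≐-sym R≐S x y = swap (R≐S x y)

  ≐⇒⊆ᵈ : {R S : BinRel X} → R ≐ S → R ⊆ᵈ S
  ≐⇒⊆ᵈ R≐S x (y , Rxy) = y , proj₁ (R≐S x y) Rxy

  ≐⇒↾⊆ : {R S T : BinRel X} → R ≐ S → R ↾ T ⊆ S
  ≐⇒↾⊆ R≐S x y Rxy _ = proj₁ (R≐S x y) Rxy

  ⊆ᵈ-trans : {R S T : BinRel X} → R ⊆ᵈ S → S ⊆ᵈ T → R ⊆ᵈ T
  ⊆ᵈ-trans R⊆S S⊆T x Rx = S⊆T x (R⊆S x Rx)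

  ↾⊆-trans : {R S T U : BinRel X} → R ↾ U ⊆ S → S ↾ U ⊆ T → R ↾ U ⊆ T
  ↾⊆-trans R⊆S S⊆T x y Rxy Ux = S⊆T x y (R⊆S x y Rxy Ux) Ux

  ↾⊆-antitone : {R S T U : BinRel X} → T ⊆ᵈ U → R ↾ U ⊆ S → R ↾ T ⊆ S
  ↾⊆-antitone T⊆U R⊆S x y Rxy Tx = R⊆S x y Rxy (T⊆U x Tx)

  ↾self⇒⊆ᵈ : {R S : BinRel X} → R ↾ R ⊆ S → R ⊆ᵈ S
  ↾self⇒⊆ᵈ R⊆S x (y , Rxy) = y , R⊆S x y Rxy (y , Rxy)

  ⨾-⊆ᵈˡ : {R S : BinRel X} → R ⨾ S ⊆ᵈ R
  ⨾-⊆ᵈˡ x (y , z , Rxz , _) = z , Rxz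

  ⨾-monoʳ-⊆ᵈ : {R S S' : BinRel X} → S ⊆ᵈ S' → R ⨾ S ⊆ᵈ R ⨾ S'
  ⨾-monoʳ-⊆ᵈ S⊆S' x (y , z , Rxz , Szy) with S⊆S' z (y , Szy)
  ... | y' , S'zy' = y' , z , Rxz , S'zy'

  -- The right factor is only restricted to its own domain: the intermediate
  -- point always lies in it.
  ⨾-mono-↾⊆ : {R R' S S' T : BinRel X} →
              R ↾ T ⊆ R' → S ↾ S ⊆ S' → R ⨾ S ↾ T ⊆ R' ⨾ S'
  ⨾-mono-↾⊆ R⊆R' S⊆S' x y (z , Rxz , Szy) Tx =
    z , R⊆R' x z Rxz Tx , S⊆S' z y Szy (y , Szy)

module Soundness {S : Set} {_≤_ : S → S → Set} {_∘_ : S → S → S}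
                 (rep : Representation S _≤_ _∘_) where
  open Representation rep
  open Predicates S _≤_ _∘_

  mutual
    ◀-sound : ∀ {n a b} → ◀ n a b → θ a ⊆ᵈ θ b
    ◀-sound {zero} {a} {b} (inj₁ b≤a) = proj₁ (≤⇒⊑ b a b≤a)
    ◀-sound {zero} {a} {b} (inj₂ (c , b∘c≤a)) =
      ⊆ᵈ-trans (proj₁ (≤⇒⊑ (b ∘ c) a b∘c≤a)) (⊆ᵈ-trans (≐⇒⊆ᵈ (hom-∘ b c)) ⨾-⊆ᵈˡ)
    ◀-sound {suc n} (inj₁ a◁b) = ↾self⇒⊆ᵈ (◁-sound a◁b)
    ◀-sound {suc n} (inj₂ (inj₁ (c , a◀c , c◀b))) = ⊆ᵈ-trans (◀-sound a◀c) (◀-sound c◀b)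
    ◀-sound {suc n} (inj₂ (inj₂ (d , f , f' , refl , f◀f' , refl))) =
      ⊆ᵈ-trans (≐⇒⊆ᵈ (hom-∘ d f))
        (⊆ᵈ-trans (⨾-monoʳ-⊆ᵈ (◀-sound f◀f')) (≐⇒⊆ᵈ (≐-sym (hom-∘ d f'))))

    ◁-sound : ∀ {n s a b} → ◁ n s a b → θ a ↾ θ s ⊆ θ b
    ◁-sound {zero} {a = a} {b} (a≤b , refl) = proj₂ (≤⇒⊑ a b a≤b)
    ◁-sound {suc n} (inj₁ (c , a◁c , c◁b)) = ↾⊆-trans (◁-sound a◁c) (◁-sound c◁b)
    ◁-sound {suc n} (inj₂ (inj₁ (c , c' , d , d' , refl , c◁c' , d◁d' , refl))) =
      ↾⊆-trans (≐⇒↾⊆ (hom-∘ c d))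
        (↾⊆-trans (⨾-mono-↾⊆ (◁-sound c◁c') (◁-sound d◁d')) (≐⇒↾⊆ (≐-sym (hom-∘ c' d'))))
    ◁-sound {suc n} (inj₂ (inj₂ (s' , a◁b , s◀s'))) = ↾⊆-antitone (◀-sound s◀s') (◁-sound a◁b)

lemma3 : (S : Set) (_≤_ : S → S → Set) (_∘_ : S → S → S)
    → Representation S _≤_ _∘_
    → Predicates.σ S _≤_ _∘_
lemma3 S _≤_ _∘_ rep a b (_ , b◀a) (_ , a◁b) =
  ⊑⇒≤ a b (◀-sound b◀a , ◁-sound a◁b)
  where
    open Representation rep
    open Soundness rep
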